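{- Let $k\in\mathbb{N}_0$ and let $G \in F(\chi,k)$. Then $\Delta(G) = |V(G)|-1$ and $\chi(G)=|V(G)| - k - 1$.
   Context: All graphs are finite and simple. $\Delta(H)$ denotes the maximum degree, $\chi(H)$ the chromatic number of $H$. For $k\in\mathbb{N}_0$, $\varUpsilon_k$ is the class of graphs $G$ such that every induced subgraph $H$ of $G$ (including $G$ itself) satisfies $\Delta(H)\le \chi(H)+k-1$. $F(\chi,k)$ denotes the set of minimal forbidden induced subgraphs of $\varUpsilon_k$: $F\in F(\chi,k)$ iff $F\notin\varUpsilon_k$ and every proper induced subgraph of $F$ lies in $\varUpsilon_k$. -}

module Defs where

open import Data.Nat using (ℕ; zero; suc; _+_; _≤_; _<_; _⊔_)
open import Data.Bool using (Bool; true; false; if_then_else_)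
open import Data.Fin using (Fin)
open import Data.List using (List; map; foldr; allFin)
open import Data.Nat.ListAction using (sum)
open import Data.Product using (Σ; _×_)
open import Function.Bundles using (_↣_; Injection)
open import Relation.Binary.PropositionalEquality using (_≡_; _≢_)
open import Relation.Nullary using (¬_)

record Graph (n : ℕ) : Set where
  field
    adj    : Fin n → Fin n → Bool
    sym    : ∀ u v → adj u v ≡ adj v u
    irrefl : ∀ v → adj v v ≡ false
open Graph public

induce : ∀ {m n} → Graph n → (Fin m ↣ Fin n) → Graph m
induce G e = record
  { adj    = λ u v → adj G (f u) (f v)
  ; sym    = λ u v → sym G (f u) (f v)
  ; irrefl = λ v → irrefl G (f v)
  }
  where f = Injection.to e

degree : ∀ {n} → Graph n → Fin n → ℕ
degree {n} G v = sum (map (λ u → if adj G v u then 1 else 0) (allFin n))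

-- Maximum degree (0 for the empty graph).
Δ : ∀ {n} → Graph n → ℕ
Δ {n} G = foldr _⊔_ 0 (map (degree G) (allFin n))

Colorable : ∀ {n} → Graph n → ℕ → Set
Colorable {n} G c =
  Σ (Fin n → Fin c) λ col → ∀ u v → adj G u v ≡ true → col u ≢ col v

IsChromaticNumber : ∀ {n} → Graph n → ℕ → Set
IsChromaticNumber G c = Colorable G c × (∀ c' → c' < c → ¬ Colorable G c')

-- G ∈ Υ_k : every (nonempty) induced subgraph H satisfies Δ(H) ≤ χ(H) + k - 1,
-- written as Δ(H) + 1 ≤ χ(H) + k.
InΥ : ℕ → ∀ {n} → Graph n → Set
InΥ k {n} G =
  ∀ m (e : Fin m ↣ Fin n) → 0 < m →
  ∀ c → IsChromaticNumber (induce G e) c → Δ (induce G e) + 1 ≤ c + k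

InF : ℕ → ∀ {n} → Graph n → Set
InF k {n} G =
  ¬ InΥ k G × (∀ m (e : Fin m ↣ Fin n) → m < n → InΥ k (induce G e))

module Submission where

-- Some nonempty induced subgraph H of G violates Δ(H) + 1 ≤ χ(H) + k,
-- and by minimality H uses all n vertices, so H is G relabelled by a
-- bijection.  Let c = χ(H), let v be a vertex of maximum degree Δ(H) ≥ c + k
-- and let u ≠ v.  The graph H - u is a proper induced subgraph, hence in Υ_k,
-- and χ(H - u) ≤ c, so  deg_H(v) ≤ [v ~ u] + deg_{H-u}(v) ≤ [v ~ u] + c + k - 1.
-- Since deg_H(v) ≥ c + k this forces v ~ u.  Thus v dominates H, so
-- Δ(H) = n - 1, and the same inequality (now with [v ~ u] = 1) gives
-- n - 1 ≤ c + k ≤ Δ(H) = n - 1.  Transporting along the bijection yields the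
-- claim for G.

open import Defs hiding (sym)
open import Data.Nat using (ℕ; zero; suc; _+_; _≤_; _<_; _⊔_; z≤n; s≤s; _≤?_; _<?_; _≟_)
open import Data.Nat.Properties
open import Algebra.Properties.CommutativeSemigroup +-commutativeSemigroup using (x∙yz≈y∙xz)
open import Data.Bool using (Bool; true; false; if_then_else_)
import Data.Bool as Bool
open import Data.Fin using (Fin; zero; suc; punchIn; punchOut; inject≤)
open import Data.Fin.Properties
  using (punchInᵢ≢i; punchIn-injective; punchOut-injective; punchIn-punchOut;
         any?; all?; inject≤-injective; injective⇒≤)
  renaming (_≟_ to _≟ᶠ_)
open import Data.List using (foldr; tabulate)
open import Data.List.Properties using (map-tabulate)
open import Data.Nat.ListAction using (sum)
open import Data.Product using (Σ; _×_; _,_; proj₁; proj₂; ∃)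
open import Data.Sum using (inj₁; inj₂)
open import Data.Empty using (⊥-elim)
open import Function using (_∘_; id)
open import Function.Bundles using (_↣_; Injection; mk↣)
open import Function.Construct.Composition using (_↣-∘_)
open import Function.Construct.Identity using (↣-id)
open import Relation.Binary.PropositionalEquality
open import Relation.Binary.Definitions using (tri<; tri≈; tri>)
open import Relation.Nullary using (¬_; Dec; yes; no; ¬?)
open import Relation.Nullary.Decidable using (_→-dec_; _×-dec_; decidable-stable)

bit : Bool → ℕ
bit b = if b then 1 else 0

bit≤1 : ∀ b → bit b ≤ 1
bit≤1 true  = ≤-refl
bit≤1 false = z≤n

bit-forced : ∀ b d → d + 1 ≤ bit b + d → b ≡ true
bit-forced true  d _  = refl
bit-forced false d le = ⊥-elim (1+n≰n (subst (_≤ d) (+-comm d 1) le))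

count : ∀ n → (Fin n → Bool) → ℕ
count n P = sum (tabulate (bit ∘ P))

count≤ : ∀ n (P : Fin n → Bool) → count n P ≤ n
count≤ zero    P = z≤n
count≤ (suc n) P = +-mono-≤ (bit≤1 (P zero)) (count≤ n (P ∘ suc))

count-true : ∀ n (P : Fin n → Bool) → (∀ i → P i ≡ true) → count n P ≡ n
count-true zero    P all = refl
count-true (suc n) P all =
  cong₂ _+_ (cong bit (all zero)) (count-true n (P ∘ suc) (all ∘ suc))

count-punchIn : ∀ n (w : Fin (suc n)) (P : Fin (suc n) → Bool) →
  count (suc n) P ≡ bit (P w) + count n (P ∘ punchIn w)
count-punchIn n       zero    P = refl
count-punchIn (suc n) (suc w) P = begin
  bit (P zero) + count (suc n) (P ∘ suc)
    ≡⟨ cong (bit (P zero) +_) (count-punchIn n w (P ∘ suc)) ⟩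
  bit (P zero) + (bit (P (suc w)) + rest)
    ≡⟨ x∙yz≈y∙xz (bit (P zero)) (bit (P (suc w))) rest ⟩
  bit (P (suc w)) + (bit (P zero) + rest) ∎
  where
  open ≡-Reasoning
  rest = count n (P ∘ suc ∘ punchIn w)

maxOver : ∀ n → (Fin n → ℕ) → ℕ
maxOver n f = foldr _⊔_ 0 (tabulate f)

maxOver-ub : ∀ n (f : Fin n → ℕ) i → f i ≤ maxOver n f
maxOver-ub (suc n) f zero    = m≤m⊔n _ _
maxOver-ub (suc n) f (suc i) = ≤-trans (maxOver-ub n (f ∘ suc) i) (m≤n⊔m _ _)

maxOver-lub : ∀ n (f : Fin n → ℕ) d → (∀ i → f i ≤ d) → maxOver n f ≤ d
maxOver-lub zero    f d bound = z≤n
maxOver-lub (suc n) f d bound =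
  ⊔-lub (bound zero) (maxOver-lub n (f ∘ suc) d (bound ∘ suc))

maxOver-attained : ∀ n (f : Fin (suc n) → ℕ) → ∃ λ i → f i ≡ maxOver (suc n) f
maxOver-attained zero    f = zero , sym (⊔-identityʳ (f zero))
maxOver-attained (suc n) f with ⊔-sel (f zero) (maxOver (suc n) (f ∘ suc))
... | inj₁ atZero = zero , sym atZero
... | inj₂ atRest with maxOver-attained n (f ∘ suc)
...   | i , fi≡max = suc i , trans fi≡max (sym atRest)

vertex⇒0< : ∀ {n} → Fin n → 0 < n
vertex⇒0< zero    = s≤s z≤n
vertex⇒0< (suc _) = s≤s z≤n

≤-if-inhabited : ∀ n x → (Fin n → n ≤ x) → n ≤ x
≤-if-inhabited zero    x _     = z≤n
≤-if-inhabited (suc n) x bound = bound zero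

degree≡count : ∀ {n} (G : Graph n) v → degree G v ≡ count n (adj G v)
degree≡count {n} G v = cong sum (map-tabulate id (λ u → bit (adj G v u)))

Δ≡maxOver : ∀ {n} (G : Graph n) → Δ G ≡ maxOver n (degree G)
Δ≡maxOver {n} G = cong (foldr _⊔_ 0) (map-tabulate id (degree G))

degree≤Δ : ∀ {n} (G : Graph n) v → degree G v ≤ Δ G
degree≤Δ {n} G v = subst (degree G v ≤_) (sym (Δ≡maxOver G)) (maxOver-ub n (degree G) v)

Δ-attained : ∀ {n} (G : Graph (suc n)) → ∃ λ v → degree G v ≡ Δ G
Δ-attained {n} G with maxOver-attained n (degree G)
... | v , maximal = v , trans maximal (sym (Δ≡maxOver G))

Δ≤n : ∀ {n} (G : Graph (suc n)) → Δ G ≤ n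
Δ≤n {n} G = subst (_≤ n) (sym (Δ≡maxOver G)) (maxOver-lub (suc n) (degree G) n degree≤n)
  where
  degree≤n : ∀ v → degree G v ≤ n
  degree≤n v rewrite degree≡count G v | count-punchIn n v (adj G v) | irrefl G v =
    count≤ n (adj G v ∘ punchIn v)

Dominating : ∀ {n} → Graph n → Fin n → Set
Dominating G v = ∀ u → u ≢ v → adj G v u ≡ true

degree-dominating : ∀ {n} (G : Graph (suc n)) v → Dominating G v → degree G v ≡ n
degree-dominating {n} G v dom = begin
  degree G v                             ≡⟨ degree≡count G v ⟩
  count (suc n) (adj G v)                ≡⟨ count-punchIn n v (adj G v) ⟩
  bit (adj G v v) + count n (adj G v ∘ punchIn v)
    ≡⟨ cong₂ _+_ (cong bit (irrefl G v)) (count-true n _ (λ j → dom _ (punchInᵢ≢i v j))) ⟩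
  n                                      ∎
  where open ≡-Reasoning

delete : ∀ {n} → Fin (suc n) → Fin n ↣ Fin (suc n)
delete w = mk↣ {to = punchIn w} (punchIn-injective w _ _)

degree-delete : ∀ {n} (H : Graph (suc n)) {u v} (u≢v : u ≢ v) →
  degree H v ≡ bit (adj H v u) + degree (induce H (delete u)) (punchOut u≢v)
degree-delete {n} H {u} {v} u≢v = begin
  degree H v                                       ≡⟨ degree≡count H v ⟩
  count (suc n) (adj H v)                          ≡⟨ count-punchIn n u (adj H v) ⟩
  bit (adj H v u) + count n (adj H v ∘ punchIn u)
    ≡⟨ cong (λ x → bit (adj H v u) + count n (adj H x ∘ punchIn u)) (sym (punchIn-punchOut u≢v)) ⟩
  bit (adj H v u) + count n (adj (induce H (delete u)) (punchOut u≢v))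
    ≡⟨ cong (bit (adj H v u) +_) (sym (degree≡count (induce H (delete u)) (punchOut u≢v))) ⟩
  bit (adj H v u) + degree (induce H (delete u)) (punchOut u≢v) ∎
  where open ≡-Reasoning

-- If e missed some y, discarding y would give an injection Fin (suc n) → Fin n.
↣-surjective : ∀ {n} (e : Fin n ↣ Fin n) y → ∃ λ x → Injection.to e x ≡ y
↣-surjective {zero}  e ()
↣-surjective {suc n} e y with any? (λ x → Injection.to e x ≟ᶠ y)
... | yes hit = hit
... | no miss = ⊥-elim (1+n≰n (injective⇒≤ avoidY-injective))
  where
  f = Injection.to e
  y≢fx : ∀ x → y ≢ f x
  y≢fx x y≡fx = miss (x , sym y≡fx)
  avoidY : Fin (suc n) → Fin n
  avoidY x = punchOut (y≢fx x)
  avoidY-injective : ∀ {a b} → avoidY a ≡ avoidY b → a ≡ b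
  avoidY-injective eq = Injection.injective e (punchOut-injective (y≢fx _) (y≢fx _) eq)

dominating-relabel : ∀ {n} (G : Graph n) (e : Fin n ↣ Fin n) v →
  Dominating (induce G e) v → Dominating G (Injection.to e v)
dominating-relabel G e v dom x x≢fv with ↣-surjective e x
... | y , refl = dom y (λ { refl → x≢fv refl })

colorable-mono : ∀ {n} (G : Graph n) {a b} → a ≤ b → Colorable G a → Colorable G b
colorable-mono G a≤b (col , proper) =
  (λ u → inject≤ (col u) a≤b) ,
  λ u v u~v same → proper u v u~v (inject≤-injective a≤b a≤b _ _ same)

colorable-induce : ∀ {m n} (G : Graph n) (e : Fin m ↣ Fin n) {c} →
  Colorable G c → Colorable (induce G e) c
colorable-induce G e (col , proper) = col ∘ Injection.to e , λ u v → proper _ _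

colorable-relabel : ∀ {n} (G : Graph n) (e : Fin n ↣ Fin n) {c} →
  Colorable (induce G e) c → Colorable G c
colorable-relabel G e (col , proper) = col ∘ preimage , λ y z y~z →
  proper (preimage y) (preimage z)
    (trans (cong₂ (adj G) (proj₂ (↣-surjective e y)) (proj₂ (↣-surjective e z))) y~z)
  where
  preimage = λ y → proj₁ (↣-surjective e y)

colorable-order : ∀ {n} (G : Graph n) → Colorable G n
colorable-order G = id , proper
  where
  proper : ∀ u v → adj G u v ≡ true → u ≢ v
  proper u .u u~u refl with trans (sym (irrefl G u)) u~u
  ... | ()

extend : ∀ {n} {A : Set} → A → (Fin n → A) → Fin (suc n) → A
extend a g zero    = a
extend a g (suc i) = g i

∃-function? : ∀ n c (Q : (Fin n → Fin c) → Set) →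
  (∀ f g → (∀ i → f i ≡ g i) → Q f → Q g) → (∀ f → Dec (Q f)) → Dec (Σ _ Q)
∃-function? zero c Q ext Q? with Q? (λ ())
... | yes q = yes (_ , q)
... | no ¬q = no λ { (f , qf) → ¬q (ext f _ (λ ()) qf) }
∃-function? (suc n) c Q ext Q? with any? (λ a → ∃-function? n c (Q ∘ extend a)
    (λ f g f≗g → ext (extend a f) (extend a g) λ { zero → refl ; (suc i) → f≗g i })
    (Q? ∘ extend a))
... | yes (a , g , q) = yes (_ , q)
... | no ¬found = no λ { (f , qf) → ¬found (f zero , f ∘ suc ,
        ext f _ (λ { zero → refl ; (suc i) → refl }) qf) }

colorable? : ∀ {n} (G : Graph n) c → Dec (Colorable G c)
colorable? {n} G c = ∃-function? n c (λ col → ∀ u v → adj G u v ≡ true → col u ≢ col v)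
  (λ f g f≗g proper u v u~v same → proper u v u~v (trans (f≗g u) (trans same (sym (f≗g v)))))
  (λ col → all? λ u → all? λ v →
     (adj G u v Bool.≟ true) →-dec ¬? (col u ≟ᶠ col v))

chromatic-exists : ∀ {n} (G : Graph n) c → Colorable G c →
  Σ ℕ λ χ → IsChromaticNumber G χ × χ ≤ c
chromatic-exists G zero    col = zero , (col , λ _ ()) , z≤n
chromatic-exists G (suc c) col with colorable? G c
... | yes colC = let χ , isχ , χ≤c = chromatic-exists G c colC in χ , isχ , m≤n⇒m≤1+n χ≤c
... | no ¬colC = suc c , (col , λ c' c'<1+c colC' →
        ¬colC (colorable-mono G (≤-pred c'<1+c) colC')) , ≤-refl

chromatic-unique : ∀ {n} (G : Graph n) {a b} →
  IsChromaticNumber G a → IsChromaticNumber G b → a ≡ b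
chromatic-unique G {a} {b} χa χb with <-cmp a b
... | tri< a<b _ _ = ⊥-elim (proj₂ χb a a<b (proj₁ χa))
... | tri≈ _ a≡b _ = a≡b
... | tri> _ _ b<a = ⊥-elim (proj₂ χa b b<a (proj₁ χb))

chromatic-relabel : ∀ {n} (G : Graph n) (e : Fin n ↣ Fin n) {c} →
  IsChromaticNumber (induce G e) c → IsChromaticNumber G c
chromatic-relabel G e (col , minimal) =
  colorable-relabel G e col , λ c' c'<c colG → minimal c' c'<c (colorable-induce G e colG)

deletion-bound : ∀ k {n} (H : Graph (suc n)) {c} → IsChromaticNumber H c →
  (∀ w → InΥ k (induce H (delete w))) →
  ∀ {u v} → u ≢ v → degree H v + 1 ≤ bit (adj H v u) + (c + k)
deletion-bound k {n} H {c} (colH , _) deletionsInΥ {u} {v} u≢v = begin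
  degree H v + 1                       ≡⟨ cong (_+ 1) (degree-delete H u≢v) ⟩
  bit (adj H v u) + degree H-u v' + 1  ≡⟨ +-assoc (bit (adj H v u)) _ 1 ⟩
  bit (adj H v u) + (degree H-u v' + 1)
    ≤⟨ +-monoʳ-≤ (bit (adj H v u)) (≤-trans (+-monoˡ-≤ 1 (degree≤Δ H-u v')) Δ+1≤c+k) ⟩
  bit (adj H v u) + (c + k)            ∎
  where
  open ≤-Reasoning
  v' = punchOut u≢v
  H-u = induce H (delete u)
  χ-u = chromatic-exists H-u c (colorable-induce H (delete u) colH)
  Δ+1≤c+k : Δ H-u + 1 ≤ c + k
  Δ+1≤c+k = ≤-trans (deletionsInΥ u n (↣-id _) (vertex⇒0< v') (proj₁ χ-u) (proj₁ (proj₂ χ-u)))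
                    (+-monoˡ-≤ k (proj₂ (proj₂ χ-u)))

violator-structure : ∀ k {n} (H : Graph (suc n)) {c} → IsChromaticNumber H c →
  (∀ w → InΥ k (induce H (delete w))) → c + k ≤ Δ H →
  (∃ λ v → Dominating H v) × c + k ≡ n
violator-structure k {n} H {c} χH deletionsInΥ violation = (v , dominating) , c+k≡n
  where
  open ≤-Reasoning
  v = proj₁ (Δ-attained H)
  deg-v≡Δ : degree H v ≡ Δ H
  deg-v≡Δ = proj₂ (Δ-attained H)
  bound : ∀ {u} → u ≢ v → degree H v + 1 ≤ bit (adj H v u) + (c + k)
  bound = deletion-bound k H χH deletionsInΥ
  -- A maximum-degree vertex is adjacent to every other vertex u,
  -- because deg(v) ≥ c + k leaves no room for [v ~ u] = 0.
  dominating : Dominating H v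
  dominating u u≢v = bit-forced (adj H v u) (Δ H) (begin
    Δ H + 1                     ≡⟨ cong (_+ 1) (sym deg-v≡Δ) ⟩
    degree H v + 1              ≤⟨ bound u≢v ⟩
    bit (adj H v u) + (c + k)   ≤⟨ +-monoʳ-≤ (bit (adj H v u)) violation ⟩
    bit (adj H v u) + Δ H       ∎)
  Δ≡n : Δ H ≡ n
  Δ≡n = trans (sym deg-v≡Δ) (degree-dominating H v dominating)
  n≤c+k : n ≤ c + k
  n≤c+k = ≤-if-inhabited n (c + k) λ j → let u≢v = punchInᵢ≢i v j in ≤-pred (begin
    suc n                       ≡⟨ +-comm 1 n ⟩
    n + 1                       ≡⟨ cong (_+ 1) (sym (degree-dominating H v dominating)) ⟩
    degree H v + 1              ≤⟨ bound u≢v ⟩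
    bit (adj H v _) + (c + k)   ≤⟨ +-monoˡ-≤ (c + k) (bit≤1 (adj H v _)) ⟩
    suc (c + k)                 ∎)
  c+k≡n : c + k ≡ n
  c+k≡n = ≤-antisym (subst (c + k ≤_) Δ≡n violation) n≤c+k

Conclusion : ℕ → ∀ n → Graph n → Set
Conclusion k n G = (Δ G + 1 ≡ n) × Σ ℕ (λ c → IsChromaticNumber G c × c + k + 1 ≡ n)

-- The conclusion is decidable: χ(G) exists, and the rest are equations in ℕ.
conclusion? : ∀ k n (G : Graph n) → Dec (Conclusion k n G)
conclusion? k n G = (Δ G + 1 ≟ n) ×-dec chromatic-equation?
  where
  χG = chromatic-exists G n (colorable-order G)
  isχG : IsChromaticNumber G (proj₁ χG)
  isχG = proj₁ (proj₂ χG)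
  chromatic-equation? : Dec (Σ ℕ λ c → IsChromaticNumber G c × c + k + 1 ≡ n)
  chromatic-equation? with proj₁ χG + k + 1 ≟ n
  ... | yes eq = yes (_ , isχG , eq)
  ... | no ne  = no λ { (c , isχ , eq) →
          ne (subst (λ x → x + k + 1 ≡ n) (chromatic-unique G isχ isχG) eq) }

ProperSubgraphsInΥ : ℕ → ∀ {n} → Graph n → Set
ProperSubgraphsInΥ k {n} G = ∀ m (e : Fin m ↣ Fin n) → m < n → InΥ k (induce G e)

full-violation : ∀ k {n} (G : Graph (suc n)) → ProperSubgraphsInΥ k G →
  (e : Fin (suc n) ↣ Fin (suc n)) → ∀ {c} → IsChromaticNumber (induce G e) c →
  c + k ≤ Δ (induce G e) → Conclusion k (suc n) G
full-violation k {n} G proper e {c} χH violation =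
  trans (+-comm (Δ G) 1) (cong suc Δ≡n) ,
  c , chromatic-relabel G e χH , trans (+-comm (c + k) 1) (cong suc c+k≡n)
  where
  structure = violator-structure k (induce G e) χH
                (λ w → proper n (e ↣-∘ delete w) ≤-refl) violation
  c+k≡n = proj₂ structure
  v = proj₁ (proj₁ structure)
  dominatingG : Dominating G (Injection.to e v)
  dominatingG = dominating-relabel G e v (proj₂ (proj₁ structure))
  Δ≡n : Δ G ≡ n
  Δ≡n = ≤-antisym (Δ≤n G)
    (subst (_≤ Δ G) (degree-dominating G _ dominatingG) (degree≤Δ G _))

full-bound : ∀ k {n} (G : Graph n) → ProperSubgraphsInΥ k G → ¬ Conclusion k n G →
  (e : Fin n ↣ Fin n) → 0 < n → ∀ c → IsChromaticNumber (induce G e) c →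
  Δ (induce G e) + 1 ≤ c + k
full-bound k {suc n} G proper ¬conclusion e _ c χH with Δ (induce G e) + 1 ≤? c + k
... | yes ok       = ok
... | no violation = ⊥-elim (¬conclusion (full-violation k G proper e χH
        (≤-pred (subst (suc (c + k) ≤_) (+-comm (Δ (induce G e)) 1) (≰⇒> violation)))))

InΥ-from-cases : ∀ k {n} (G : Graph n) → ProperSubgraphsInΥ k G →
  (∀ (e : Fin n ↣ Fin n) → 0 < n → ∀ c → IsChromaticNumber (induce G e) c →
     Δ (induce G e) + 1 ≤ c + k) →
  InΥ k G
InΥ-from-cases k {n} G proper full m e 0<m with m <? n
... | yes m<n = proper m e m<n m (↣-id _) 0<m
... | no m≮n with refl ← ≤-antisym (injective⇒≤ (Injection.injective e)) (≮⇒≥ m≮n) =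
  full e 0<m

-- Since the conclusion is decidable it suffices to refute its negation, and
-- without the conclusion both cases above show G ∈ Υ_k, contradicting G ∉ Υ_k.
corollary1 : ∀ (k n : ℕ) (G : Graph n) → InF k G →
    (Δ G + 1 ≡ n) × Σ ℕ (λ c → IsChromaticNumber G c × c + k + 1 ≡ n)
corollary1 k n G (notInΥ , proper) =
  decidable-stable (conclusion? k n G) λ ¬conclusion →
    notInΥ (InΥ-from-cases k G proper (full-bound k G proper ¬conclusion))
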